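{- Let $\mathcal D$ be a data-system over a constructor vocabulary $\mathcal C$, and let $\mathcal S$ and $\mathcal Q$ be $\mathcal D$-correct structures. If $a\in|\mathcal S|$ and $b\in|\mathcal Q|$ have the same (constructor-)decomposition, then for every type-identifier $\mathbf D$ of $\mathcal D$: $a\in\mathbf D_{\mathcal S}$ iff $b\in\mathbf D_{\mathcal Q}$.
   Context: A constructor vocabulary $\mathcal C$ is a finite set of constructors with arities $\ge0$. A hyper-term is a possibly infinite ordered tree labelled by constructors, a node labelled by an $r$-ary constructor having exactly $r$ children. A constructor-statement for $x$ is $\exists y_1\dots y_r(x=\mathbf c(y_1,\dots,y_r)\wedge\mathbf Q_1(y_1)\wedge\cdots\wedge\mathbf Q_r(y_r))$ with distinct $y_i$ and unary type-identifiers $\mathbf Q_i$. A data-system $\mathcal D$ is a finite sequence of bundles $\vec{\mathbf D}_1,\dots,\vec{\mathbf D}_k$ of type-identifiers, each inductive or coinductive: an inductive bundle $\vec{\mathbf D}_i$ has construction rules $\forall\vec y(\mathbf Q_1(y_1)\wedge\cdots\wedge\mathbf Q_r(y_r)\rightarrow\mathbf D(\mathbf c(\vec y)))$ with $\mathbf D$ in $\vec{\mathbf D}_i$, $\mathbf Q_j$ in $\vec{\mathbf D}_1,\dots,\vec{\mathbf D}_i$; a coinductive bundle has for each of its $\mathbf D$ a deconstruction rule $\forall x(\mathbf D(x)\rightarrow\psi_1\vee\cdots\vee\psi_l)$ with $\psi_j$ constructor-statements for $x$ over types in $\vec{\mathbf D}_1,\dots,\vec{\mathbf D}_i$. A $\mathcal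 D$-structure has a vocabulary containing $\mathcal C$ and the type-identifiers of $\mathcal D$; it is $\mathcal D$-correct if (1) constructors are interpreted by injective functions with pairwise disjoint ranges; (2) each inductive bundle $(\mathbf D_{i1},\dots,\mathbf D_{im})$ is interpreted by the least $m$-tuple of subsets of the universe closed under its construction rules (earlier bundles interpreted as in the structure); (3) each coinductive bundle is interpreted by the greatest $m$-tuple of subsets of the universe each element of whose $j$-th component satisfies the right-hand side of the deconstruction rule of $\mathbf D_{ij}$. $\mathbf D_{\mathcal S}$ is the interpretation of $\mathbf D$ in $\mathcal S$. A $\mathcal C$-decomposition of $a\in|\mathcal S|$ is a finitely-branching ordered tree of pairs in $|\mathcal S|\times\mathcal C$ with root $\langle a,\mathbf c\rangle$, such that if $\langle b,\mathbf c\rangle$ has children $\langle b_1,\mathbf c_1\rangle,\dots,\langle b_r,\mathbf c_r\rangle$ then $\mathbf c$ has arity $r$ and $b=\mathbf c_{\mathcal S}(b_1,\dots,b_r)$; replacing each node $\langle b,\mathbf c\rangle$ by $\mathbf c$ yields a hyper-term, the (constructor-)decomposition of $a$ (unique when it exists, in a $\mathcal D$-correct structure). -}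

module Defs where

open import Level using (Level) renaming (suc to lsuc)
open import Data.Nat using (ℕ; _≤_)
open import Data.Fin using (Fin; toℕ; _<_)
open import Data.Vec using (Vec; lookup)
open import Data.List using (List; []; _∷_; _++_; [_])
open import Data.List.Relation.Unary.All using (All)
open import Data.List.Relation.Unary.Any using (Any)
open import Data.Maybe using (Maybe; just; nothing; map)
open import Data.Product using (Σ; ∃; _×_; _,_; proj₁; proj₂; Σ-syntax; ∃-syntax)
open import Relation.Binary.PropositionalEquality using (_≡_; _≢_)

record Vocab : Set where
  field
    nCon  : ℕ
    arity : Fin nCon → ℕ

module _ (V : Vocab) where
  open Vocab V

  Con : Set
  Con = Fin nCon

  -- Type-identifier references usable in the rules of bundle i of a
  -- data-system with k bundles of sizes `size`: either an identifier of
  -- bundle i itself, or one of an earlier bundle i' < i.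

  data TRef {k : ℕ} (size : Fin k → ℕ) (i : Fin k) : Set where
    here    : Fin (size i) → TRef size i
    earlier : (i' : Fin k) → i' < i → Fin (size i') → TRef size i

  -- Construction rule  ∀ȳ (Q₁(y₁) ∧ … ∧ Q_r(y_r) → D_j(c(ȳ)))  of bundle i.
  record ConsRule {k : ℕ} (size : Fin k → ℕ) (i : Fin k) : Set where
    constructor consRule
    field
      target : Fin (size i)
      con    : Con
      args   : Vec (TRef size i) (arity con)

  -- Constructor-statement  ∃ȳ (x = c(ȳ) ∧ Q₁(y₁) ∧ … ∧ Q_r(y_r)).
  record ConStmt {k : ℕ} (size : Fin k → ℕ) (i : Fin k) : Set where
    constructor conStmt
    field
      con  : Con
      args : Vec (TRef size i) (arity con)

  data Kind : Set where
    isInductive isCoinductive : Kind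

  -- Rules of a bundle: an inductive bundle has a finite list of
  -- construction rules; a coinductive bundle has, for each of its
  -- identifiers D_j, a deconstruction rule D_j(x) → ψ₁ ∨ … ∨ ψ_l,
  -- given by the list [ψ₁, …, ψ_l] of constructor-statements.
  Rules : {k : ℕ} (size : Fin k → ℕ) → Kind → Fin k → Set
  Rules size isInductive   i = List (ConsRule size i)
  Rules size isCoinductive i = Fin (size i) → List (ConStmt size i)

  record DataSystem : Set where
    field
      k     : ℕ
      size  : Fin k → ℕ
      kind  : Fin k → Kind
      rules : (i : Fin k) → Rules size (kind i) i

    TypeId : Set
    TypeId = Σ[ i ∈ Fin k ] Fin (size i)

  module _ (D : DataSystem) where
    open DataSystem D

    -- A D-structure (only the symbols of C and of D matter).
    record Structure : Set₁ where
      field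
        Carrier : Set
        conI    : (c : Con) → Vec Carrier (arity c) → Carrier
        typI    : (i : Fin k) → Fin (size i) → Carrier → Set

    module _ (S : Structure) where
      open Structure S

      ⟦_⟧ref : {i : Fin k} → TRef size i → (Fin (size i) → Carrier → Set) → Carrier → Set
      ⟦ here j ⟧ref        X = X j
      ⟦ earlier i' _ j ⟧ref X = typI i' j

      ArgsSat : {i : Fin k} {c : Con} → Vec (TRef size i) (arity c) →
                (Fin (size i) → Carrier → Set) → Vec Carrier (arity c) → Set
      ArgsSat qs X ys = ∀ l → ⟦ lookup qs l ⟧ref X (lookup ys l)

      Closed : {i : Fin k} → List (ConsRule size i) → (Fin (size i) → Carrier → Set) → Set
      Closed rs X = All (λ r → let open ConsRule r in
                       (ys : Vec Carrier (arity con)) → ArgsSat args X ys →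
                       X target (conI con ys)) rs

      SatStmt : {i : Fin k} → ConStmt size i → (Fin (size i) → Carrier → Set) → Carrier → Set
      SatStmt st X x = let open ConStmt st in
        Σ[ ys ∈ Vec Carrier (arity con) ] (x ≡ conI con ys × ArgsSat args X ys)

      Consistent : {i : Fin k} → (Fin (size i) → Carrier → Set) →
                   (Fin (size i) → List (ConStmt size i)) → Set
      Consistent X ψs = ∀ j x → X j x → Any (λ st → SatStmt st X x) (ψs j)

      BundleCorrect : (i : Fin k) (κ : Kind) → Rules size κ i → Set₁
      BundleCorrect i isInductive rs =
        Closed rs (typI i) ×
        ((X : Fin (size i) → Carrier → Set) → Closed rs X → ∀ j x → typI i j x → X j x)
      BundleCorrect i isCoinductive ψs =
        Consistent (typI i) ψs ×
        ((X : Fin (size i) → Carrier → Set) → Consistent X ψs → ∀ j x → X j x → typI i j x)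

      record Correct : Set₁ where
        field
          injective : (c : Con) (xs ys : Vec Carrier (arity c)) → conI c xs ≡ conI c ys → xs ≡ ys
          disjoint  : (c c' : Con) (xs : Vec Carrier (arity c)) (ys : Vec Carrier (arity c')) →
                      c ≢ c' → conI c xs ≢ conI c' ys
          bundles   : (i : Fin k) → BundleCorrect i (kind i) (rules i)

      -- Nodes of an ordered, finitely branching, possibly
      -- infinite tree are addressed by paths (lists of child indices, root
      -- first); the tree is a partial labelling of paths by pairs in
      -- |S| × C.
      record Decomposition (a : Carrier) : Set where
        field
          node     : List ℕ → Maybe (Carrier × Con)
          rootCon  : Con
          root     : node [] ≡ just (a , rootCon)
          closed   : ∀ p i → node p ≡ nothing → node (p ++ [ i ]) ≡ nothing
          children : ∀ p b c → node p ≡ just (b , c) →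
                     Σ[ bs ∈ Vec Carrier (arity c) ]
                       ((∀ (l : Fin (arity c)) → ∃[ c' ] node (p ++ [ toℕ l ]) ≡ just (lookup bs l , c'))
                       × (∀ i → arity c ≤ i → node (p ++ [ i ]) ≡ nothing)
                       × b ≡ conI c bs)

        hyperTerm : List ℕ → Maybe Con
        hyperTerm p = map proj₂ (node p)



    SameDecomposition : (S : Structure) → Structure.Carrier S →
                        (Q : Structure) → Structure.Carrier Q → Set
    SameDecomposition S a Q b =
      Σ[ d ∈ Decomposition S a ] Σ[ e ∈ Decomposition Q b ]
        (∀ p → Decomposition.hyperTerm d p ≡ Decomposition.hyperTerm e p)

-- Both structures interpret constructors injectively with disjoint ranges, so
-- elements sitting at the same address of two decompositions with equal
-- hyper-terms are built by the same constructor from elements that again sit at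
-- equal addresses: the relation "same address" is a simulation, in both
-- directions. Membership in every type then transfers along any simulation, by
-- well-founded induction on the bundle index: for an inductive bundle, the
-- elements simulated only by members of the types form a family closed under the
-- construction rules, hence contain the least one; for a coinductive bundle, the
-- elements simulating members of the types form a consistent family, hence lie
-- in the greatest one.
module Submission where

open import Defs
open import Data.Fin using (Fin; toℕ; _<_; _≟_)
open import Data.Fin.Induction using (<-wellFounded)
open import Data.Vec using (Vec; lookup)
open import Data.List using (List; []; _++_; [_])
open import Data.List.Relation.Unary.All as All using ()
open import Data.List.Relation.Unary.Any as Any using ()
open import Data.Maybe using (just; map)
open import Data.Maybe.Properties using (just-injective)
open import Data.Product using (_×_; _,_; proj₂; ∃-syntax; Σ-syntax)
open import Data.Empty using (⊥-elim)
open import Relation.Nullary using (yes; no)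
open import Relation.Binary.PropositionalEquality using (_≡_; refl; sym; trans; cong; subst)
open import Induction.WellFounded using (Acc; acc)
open import Function.Bundles using (_⇔_; mk⇔)

module _ {V : Vocab} {D : DataSystem V} where
  open Vocab V
  open DataSystem D
  open Structure

  Simulation : (S Q : Structure V D) → (Carrier S → Carrier Q → Set) → Set
  Simulation S Q R =
    ∀ {x y} → R x y → ∀ c (xs : Vec (Carrier S) (arity c)) → x ≡ conI S c xs →
    Σ[ ys ∈ Vec (Carrier Q) (arity c) ]
      (y ≡ conI Q c ys × (∀ l → R (lookup xs l) (lookup ys l)))

  module _ {S : Structure V D} (CS : Correct V D S) where
    open Correct CS

    conI-same-constructor : ∀ {c c'} {xs : Vec (Carrier S) (arity c)} {ys : Vec (Carrier S) (arity c')} →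
                            conI S c xs ≡ conI S c' ys → c ≡ c'
    conI-same-constructor {c} {c'} {xs} {ys} eq with c ≟ c'
    ... | yes c≡c' = c≡c'
    ... | no c≢c' = ⊥-elim (disjoint c c' xs ys c≢c' eq)

  module _ {S Q : Structure V D}
           (bundlesS : ∀ i → BundleCorrect V D S i (kind i) (rules i))
           (bundlesQ : ∀ i → BundleCorrect V D Q i (kind i) (rules i))
           {R : Carrier S → Carrier Q → Set} (sim : Simulation S Q R) where

    Transfers : (i : Fin k) → (Fin (size i) → Carrier S → Set) → (Fin (size i) → Carrier Q → Set) → Set
    Transfers i X Y = ∀ j {x y} → R x y → X j x → Y j y

    TypesTransfer : Fin k → Set
    TypesTransfer i = Transfers i (typI S i) (typI Q i)

    module _ {i : Fin k} (earlier-transfer : ∀ {i'} → i' < i → TypesTransfer i') where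

      ref-transfer : ∀ {X Y} → Transfers i X Y → (q : TRef V size i) →
                     ∀ {x y} → R x y → ⟦_⟧ref V D S q X x → ⟦_⟧ref V D Q q Y y
      ref-transfer X⇒Y (here j)          = X⇒Y j
      ref-transfer X⇒Y (earlier i' lt j) = earlier-transfer lt j

      args-transfer : ∀ {X Y} → Transfers i X Y → ∀ {c} (qs : Vec (TRef V size i) (arity c)) xs ys →
                      (∀ l → R (lookup xs l) (lookup ys l)) →
                      ArgsSat V D S qs X xs → ArgsSat V D Q qs Y ys
      args-transfer X⇒Y qs _ _ xs~ys sat l = ref-transfer X⇒Y (lookup qs l) (xs~ys l) (sat l)

      inductive-transfer : (rs : List (ConsRule V size i)) →
                           BundleCorrect V D S i isInductive rs → BundleCorrect V D Q i isInductive rs →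
                           TypesTransfer i
      inductive-transfer rs (_ , leastS) (closedQ , _) j x~y x∈ = leastS X closedX j _ x∈ x~y
        where
        X : Fin (size i) → Carrier S → Set
        X j x = ∀ {y} → R x y → typI Q i j y

        closedX : Closed V D S rs X
        closedX = All.map (λ { {consRule t c qs} closeQ xs sat x~y →
          let ys , y≡ , xs~ys = sim x~y c xs refl
          in subst (typI Q i t) (sym y≡) (closeQ ys (args-transfer (λ _ x~y f → f x~y) qs xs ys xs~ys sat)) })
          closedQ

      coinductive-transfer : (ψs : Fin (size i) → List (ConStmt V size i)) →
                             BundleCorrect V D S i isCoinductive ψs → BundleCorrect V D Q i isCoinductive ψs →
                             TypesTransfer i
      coinductive-transfer ψs (consistentS , _) (_ , greatestQ) j x~y x∈ =
        greatestQ Y consistentY j _ (_ , x~y , x∈)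
        where
        Y : Fin (size i) → Carrier Q → Set
        Y j y = ∃[ x ] (R x y × typI S i j x)

        consistentY : Consistent V D Q Y ψs
        consistentY j y (x , x~y , x∈) = Any.map (λ { {conStmt c qs} (xs , x≡ , sat) →
          let ys , y≡ , xs~ys = sim x~y c xs x≡
          in ys , y≡ , args-transfer (λ _ x~y x∈ → _ , x~y , x∈) qs xs ys xs~ys sat })
          (consistentS j x x∈)

    bundle-transfer : ∀ i κ (rs : Rules V size κ i) →
                      BundleCorrect V D S i κ rs → BundleCorrect V D Q i κ rs →
                      (∀ {i'} → i' < i → TypesTransfer i') → TypesTransfer i
    bundle-transfer i isInductive   rs bS bQ ih = inductive-transfer ih rs bS bQ
    bundle-transfer i isCoinductive ψs bS bQ ih = coinductive-transfer ih ψs bS bQ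

    simulation-transfers : ∀ i → Acc _<_ i → TypesTransfer i
    simulation-transfers i (acc rec) =
      bundle-transfer i (kind i) (rules i) (bundlesS i) (bundlesQ i)
        (λ lt → simulation-transfers _ (rec lt))

  module _ {S Q : Structure V D} {a : Carrier S} {b : Carrier Q}
           (d : Decomposition V D S a) (e : Decomposition V D Q b)
           (same : ∀ p → Decomposition.hyperTerm d p ≡ Decomposition.hyperTerm e p) where
    open Decomposition

    SameAddress : Carrier S → Carrier Q → Set
    SameAddress x y = ∃[ p ] ∃[ c ] (node d p ≡ just (x , c) × node e p ≡ just (y , c))

    same-label : ∀ p {x y c c'} → node d p ≡ just (x , c) → node e p ≡ just (y , c') → c ≡ c'
    same-label p eqd eqe =
      just-injective (trans (sym (cong (map proj₂) eqd)) (trans (same p) (cong (map proj₂) eqe)))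

    root-sameAddress : SameAddress a b
    root-sameAddress = [] , rootCon d , root d , subst (λ c → node e [] ≡ just (b , c))
                                                    (sym (same-label [] (root d) (root e))) (root e)

    sameAddress-simulation : Correct V D S → Simulation S Q SameAddress
    sameAddress-simulation CS (p , c , eqd , eqe) c' xs x≡
      with children d p _ c eqd | children e p _ c eqe
    ... | bs , bs-at , _ , x≡bs | ys , ys-at , _ , y≡ys
      with conI-same-constructor CS (trans (sym x≡bs) x≡)
    ... | refl with Correct.injective CS c bs xs (trans (sym x≡bs) x≡)
    ... | refl = ys , y≡ys , child
      where
      child : ∀ l → SameAddress (lookup bs l) (lookup ys l)
      child l with bs-at l | ys-at l
      ... | cₗ , eqdₗ | cₗ' , eqeₗ with same-label (p ++ [ toℕ l ]) eqdₗ eqeₗ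
      ... | refl = p ++ [ toℕ l ] , cₗ , eqdₗ , eqeₗ

corollary4p3 : (V : Vocab) (D : DataSystem V) (S Q : Structure V D) →
               Correct V D S → Correct V D Q →
               (a : Structure.Carrier S) (b : Structure.Carrier Q) →
               SameDecomposition V D S a Q b →
               (i : Fin (DataSystem.k D)) (j : Fin (DataSystem.size D i)) →
               (Structure.typI S i j a ⇔ Structure.typI Q i j b)
corollary4p3 V D S Q CS CQ a b (d , e , same) i j =
  mk⇔ (simulation-transfers bundlesS bundlesQ (sameAddress-simulation d e same CS) i (<-wellFounded i) j
         (root-sameAddress d e same))
      (simulation-transfers bundlesQ bundlesS (sameAddress-simulation e d same˘ CQ) i (<-wellFounded i) j
         (root-sameAddress e d same˘))
  where
  open Correct CS renaming (bundles to bundlesS)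
  open Correct CQ renaming (bundles to bundlesQ)
  same˘ : ∀ p → Decomposition.hyperTerm e p ≡ Decomposition.hyperTerm d p
  same˘ p = sym (same p)
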